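{- Let $n\ge 1$ and $k\ge 1$ be integers. In the hat game with $n$ prisoners and $k$ extra hats (described in the context), a perfect deterministic strategy exists if and only if $\alpha_{n,k}=\frac{(n+k)!}{(k+1)!}$, i.e. if and only if the arrangement graph $A_{n+k,n}$ has an independent set whose size is $\frac{1}{k+1}$ of its number of vertices $\frac{(n+k)!}{k!}$.
   Context: Hat game with $n$ prisoners and $k$ extra hats: prisoners numbered $1,\dots,n$ stand in a line; there are $n+k$ hats with distinct colors $1,2,\dots,n+k$. The warden assigns to the prisoners a uniformly random injective map $\{1,\dots,n\}\to\{1,\dots,n+k\}$ (prisoner $i$ gets color $x_i$; the $k$ remaining hats are discarded), so the hat assignment is a uniformly random ordered $n$-tuple $(x_1,\dots,x_n)$ of distinct elements of $\{1,\dots,n+k\}$. Prisoner $i$ sees exactly the colors $x_{i+1},\dots,x_n$. The prisoners guess their own colors in the order $1,2,\dots,n$, each hearing all earlier guesses. A deterministic strategy specifies, for each $i$, prisoner $i$'s guess as a function of $(x_{i+1},\dots,x_n)$ and the earlier guesses; it is agreed upon before the hats are placed. The prisoners win if every guess is correct. The success probability of a strategy is the fraction of the $(n+k)!/k!$ possible assignments on which they win. A strategy is perfect if its success probability equals $1/(k+1)$. The arrangement graph $A_{n+k,n}$ has as vertices all ordered $n$-tuples of distinct integers from $\{1,\dots,n+k\}$, two vertices being adjacent iff the tuples differ in exactly one coordinate; $\alpha_{n,k}$ denotes its independence number. -}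

module Defs where

open import Data.Nat using (ℕ; zero; suc; _+_; _*_; _≤_; _!; _/_)
open import Data.Nat.Properties using (_!≢0)
open import Data.Fin using (Fin)
open import Data.Fin.Properties using () renaming (_≟_ to _≟F_)
open import Data.Vec using (Vec; []; _∷_; toList)
import Data.Vec.Properties as VecP
open import Data.List using (List; []; _∷_; [_]; map; concatMap; filter; length; allFin)
open import Data.List.Membership.Propositional using (_∈_)
open import Data.List.Relation.Unary.All using (All)
open import Data.List.Relation.Unary.Unique.Propositional using (Unique)
import Data.List.Relation.Unary.Unique.DecPropositional as UDec
open import Data.Product using (Σ; _×_; _,_)
open import Data.Unit using (⊤; tt)
open import Relation.Nullary using (Dec; yes; no; ¬_; _×-dec_)
open import Relation.Binary.PropositionalEquality using (_≡_; _≢_)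

-- Hat colours 1..N are modelled as Fin N (N = n + k).
-- A hat assignment is a vector (x₁,…,xₙ) of colours; it is an
-- admissible assignment (an "arrangement") iff its entries are distinct.

Distinct : ∀ {N n} → Vec (Fin N) n → Set
Distinct x = Unique (toList x)

distinct? : ∀ {N n} (x : Vec (Fin N) n) → Dec (Distinct x)
distinct? x = UDec.unique? _≟F_ (toList x)

allVecs : (N n : ℕ) → List (Vec (Fin N) n)
allVecs N zero    = [ [] ]
allVecs N (suc n) = concatMap (λ c → map (c ∷_) (allVecs N n)) (allFin N)

arrangements : (N n : ℕ) → List (Vec (Fin N) n)
arrangements N n = filter distinct? (allVecs N n)

-- A strategy for the prisoners 1..(suc n) consists of
--   * prisoner 1's guess as a function of the hats x₂,…,x_{n+1} he sees, and
--   * for each possible guess g₁ of prisoner 1 (which everybody hears),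
--     a strategy for prisoners 2..(suc n), who see the hats behind them.
-- Unfolding, prisoner i's guess is a function of (x_{i+1},…,x_n) and of
-- the earlier guesses g₁,…,g_{i-1}, exactly as in the paper.

Strategy : (N n : ℕ) → Set
Strategy N zero    = ⊤
Strategy N (suc n) = (Vec (Fin N) n → Fin N) × (Fin N → Strategy N n)

Wins : ∀ {N} n → Strategy N n → Vec (Fin N) n → Set
Wins zero    _           []       = ⊤
Wins (suc n) (f , rest) (x ∷ xs) = (f xs ≡ x) × Wins n (rest (f xs)) xs

wins? : ∀ {N} n (s : Strategy N n) (x : Vec (Fin N) n) → Dec (Wins n s x)
wins? zero    _          []       = yes tt
wins? (suc n) (f , rest) (x ∷ xs) = (f xs ≟F x) ×-dec wins? n (rest (f xs)) xs

successCount : ∀ {N} n → Strategy N n → ℕ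
successCount {N} n s = length (filter (wins? n s) (arrangements N n))

-- perfect: success probability = 1/(k+1), i.e.
--   successCount / #arrangements = 1 / (k+1)   (cross-multiplied)
Perfect : (n k : ℕ) → Strategy (n + k) n → Set
Perfect n k s = successCount n s * suc k ≡ length (arrangements (n + k) n)

-- Arrangement graph A_{N,n}: vertices are arrangements, adjacent iff
-- they differ in exactly one coordinate.

hamming : ∀ {N n} → Vec (Fin N) n → Vec (Fin N) n → ℕ
hamming []       []       = 0
hamming (x ∷ xs) (y ∷ ys) with x ≟F y
... | yes _ = hamming xs ys
... | no  _ = suc (hamming xs ys)

Adjacent : ∀ {N n} → Vec (Fin N) n → Vec (Fin N) n → Set
Adjacent x y = hamming x y ≡ 1

IndependentSet : (N n : ℕ) → List (Vec (Fin N) n) → Set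
IndependentSet N n S =
  Unique S × All Distinct S ×
  (∀ {x y} → x ∈ S → y ∈ S → ¬ Adjacent x y)

IsIndependenceNumber : (N n m : ℕ) → Set
IsIndependenceNumber N n m =
  Σ (List (Vec (Fin N) n)) (λ S → IndependentSet N n S × length S ≡ m) ×
  (∀ S → IndependentSet N n S → length S ≤ m)

target : (n k : ℕ) → ℕ
target n k = ((n + k) !) / (suc k !) where instance _ = suc k !≢0

-- A strategy wins on a set of arrangements no two of which are adjacent: if two
-- winning arrangements differed only in coordinate i, prisoner i would see the
-- same hats and hear the same guesses on both, hence make the same guess.
-- Conversely every independent set is won by the strategy in which each
-- prisoner guesses the colour completing what he sees and hears to a member of
-- the set.  Deleting the first coordinate is injective on an independent set, so
-- α is at most the number (n+k)!/(k+1)! of arrangements of length n - 1, while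
-- there are k + 1 times as many arrangements of length n.  Hence a perfect
-- strategy exists iff α attains this bound.
module Submission where

open import Defs
open import Data.Nat using (ℕ; zero; suc; _+_; _*_; _≤_; z≤n; s≤s; _!; _/_)
open import Data.Nat.Properties
  using (≤-antisym; +-suc; +-cancelˡ-≡; *-cancelʳ-≡;
         *-assoc; *-identityˡ; suc-injective; _!≢0)
open import Data.Nat.DivMod using (m*n/n≡m)
open import Data.Nat.ListAction using (sum)
open import Data.Fin using (Fin; zero)
open import Data.Fin.Properties using (any?) renaming (_≟_ to _≟F_)
open import Data.Vec using (Vec; []; _∷_; toList; head; tail)
open import Data.Vec.Properties using (∷-injectiveˡ; ∷-injectiveʳ; length-toList; ≡-dec)
open import Data.List using (List; []; _∷_; map; concatMap; filter; length; allFin)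
open import Data.List.Properties using (length-++; length-map; length-tabulate)
open import Data.List.Membership.Propositional using (_∈_)
open import Data.List.Membership.Propositional.Properties
  using (∈-allFin; ∈-map⁺; ∈-map⁻; ∈-concat⁺′; ∈-concat⁻′; ∈-concatMap⁻;
         ∈-filter⁺; ∈-filter⁻)
import Data.List.Membership.DecPropositional as DecMembership
open import Data.List.Relation.Binary.Subset.Propositional using (_⊆_)
open import Data.List.Relation.Unary.Any using (here; there)
open import Data.List.Relation.Unary.All as All using (All)
open import Data.List.Relation.Unary.All.Properties using (¬Any⇒All¬; All¬⇒¬Any)
open import Data.List.Relation.Unary.AllPairs using ([]; _∷_)
open import Data.List.Relation.Unary.Unique.Propositional using (Unique)
open import Data.List.Relation.Unary.Unique.Propositional.Properties
  using (map⁺; ++⁺; allFin⁺; filter⁺)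
open import Data.Product using (Σ; _×_; _,_; ∃; proj₁; proj₂)
open import Data.Unit using (tt)
open import Data.Empty using (⊥-elim)
open import Function.Base using (id; _∘_)
open import Function.Bundles using (_⇔_; mk⇔; Equivalence)
open import Relation.Nullary using (Dec; yes; no; ¬_)
open import Relation.Unary using (Decidable)
open import Relation.Unary.Properties using (∁?)
open import Relation.Binary.PropositionalEquality

module _ {A B : Set} where

  private
    remove : ∀ {y : B} {ys} → y ∈ ys → List B
    remove {ys = _ ∷ ys} (here _)  = ys
    remove {ys = y ∷ _}  (there p) = y ∷ remove p

    length-remove : ∀ {y : B} {ys} (p : y ∈ ys) → length ys ≡ suc (length (remove p))
    length-remove (here _)  = refl
    length-remove (there p) = cong suc (length-remove p)

    ∈-remove : ∀ {y z : B} {ys} (p : y ∈ ys) → z ∈ ys → z ≢ y → z ∈ remove p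
    ∈-remove (here refl) (here refl) z≢y = ⊥-elim (z≢y refl)
    ∈-remove (here refl) (there q)   _   = q
    ∈-remove (there p)   (here refl) _   = here refl
    ∈-remove (there p)   (there q)   z≢y = there (∈-remove p q z≢y)

  injectiveOn⇒length≤ : (f : A → B) {xs : List A} {ys : List B} → Unique xs →
    (∀ {x y} → x ∈ xs → y ∈ xs → f x ≡ f y → x ≡ y) →
    (∀ {x} → x ∈ xs → f x ∈ ys) → length xs ≤ length ys
  injectiveOn⇒length≤ f {[]}     _            _   _    = z≤n
  injectiveOn⇒length≤ f {x ∷ xs} (x∉xs ∷ uxs) inj into
    rewrite length-remove (into (here refl)) =
    s≤s (injectiveOn⇒length≤ f uxs (λ p q → inj (there p) (there q)) into′)
    where
    into′ : ∀ {z} → z ∈ xs → f z ∈ remove (into (here refl))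
    into′ z∈xs = ∈-remove (into (here refl)) (into (there z∈xs))
      (All.lookup x∉xs z∈xs ∘ inj (here refl) (there z∈xs) ∘ sym)

  length-concatMap : (f : A → List B) (xs : List A) →
    length (concatMap f xs) ≡ sum (map (length ∘ f) xs)
  length-concatMap f []       = refl
  length-concatMap f (x ∷ xs) =
    trans (length-++ (f x)) (cong (length (f x) +_) (length-concatMap f xs))

  unique-concatMap : (key : B → A) (f : A → List B) → (∀ a → Unique (f a)) →
    (∀ {a b} → b ∈ f a → key b ≡ a) → ∀ {xs} → Unique xs → Unique (concatMap f xs)
  unique-concatMap key f uf keyf {[]}     []           = []
  unique-concatMap key f uf keyf {a ∷ as} (a∉as ∷ uas) =
    ++⁺ (uf a) (unique-concatMap key f uf keyf uas) disjoint
    where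
    disjoint : ∀ {b} → ¬ (b ∈ f a × b ∈ concatMap f as)
    disjoint (b∈fa , b∈rest) = All.lookupWith
      (λ a≢a′ b∈fa′ → a≢a′ (trans (sym (keyf b∈fa)) (keyf b∈fa′)))
      a∉as (∈-concatMap⁻ f {xs = as} b∈rest)

module _ {A : Set} where

  unique-⊆⇒length≤ : {xs ys : List A} → Unique xs → xs ⊆ ys → length xs ≤ length ys
  unique-⊆⇒length≤ uxs xs⊆ys = injectiveOn⇒length≤ id uxs (λ _ _ → id) xs⊆ys

  unique-⊆-⊇⇒length≡ : {xs ys : List A} → Unique xs → Unique ys →
    xs ⊆ ys → ys ⊆ xs → length xs ≡ length ys
  unique-⊆-⊇⇒length≡ uxs uys xs⊆ys ys⊆xs =
    ≤-antisym (unique-⊆⇒length≤ uxs xs⊆ys) (unique-⊆⇒length≤ uys ys⊆xs)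

  length-filter-∁ : {P : A → Set} (P? : Decidable P) (xs : List A) →
    length (filter P? xs) + length (filter (∁? P?) xs) ≡ length xs
  length-filter-∁ P? []       = refl
  length-filter-∁ P? (x ∷ xs) with P? x
  ... | yes _ = cong suc (length-filter-∁ P? xs)
  ... | no  _ = trans (+-suc _ _) (cong suc (length-filter-∁ P? xs))

  sum-map-const : (f : A → ℕ) {c : ℕ} (xs : List A) →
    (∀ {x} → x ∈ xs → f x ≡ c) → sum (map f xs) ≡ length xs * c
  sum-map-const f []       _  = refl
  sum-map-const f (x ∷ xs) fc = cong₂ _+_ (fc (here refl)) (sum-map-const f xs (fc ∘ there))

module _ {N : ℕ} where

  ∈-allVecs : ∀ n (v : Vec (Fin N) n) → v ∈ allVecs N n
  ∈-allVecs zero    []      = here refl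
  ∈-allVecs (suc n) (c ∷ v) =
    ∈-concat⁺′ (∈-map⁺ (c ∷_) (∈-allVecs n v)) (∈-map⁺ _ (∈-allFin c))

  allVecs-unique : ∀ n → Unique (allVecs N n)
  allVecs-unique zero    = All.[] ∷ []
  allVecs-unique (suc n) =
    unique-concatMap head (λ c → map (c ∷_) (allVecs N n))
      (λ c → map⁺ ∷-injectiveʳ (allVecs-unique n)) head≡ (allFin⁺ N)
    where
    head≡ : ∀ {c v} → v ∈ map (c ∷_) (allVecs N n) → head v ≡ c
    head≡ {c} p with ∈-map⁻ (c ∷_) p
    ... | _ , _ , refl = refl

  arrangements-unique : ∀ n → Unique (arrangements N n)
  arrangements-unique n = filter⁺ distinct? (allVecs-unique n)

  ∈-arrangements⁺ : ∀ {n} {v : Vec (Fin N) n} → Distinct v → v ∈ arrangements N n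
  ∈-arrangements⁺ {n} {v} = ∈-filter⁺ distinct? (∈-allVecs n v)

  ∈-arrangements⁻ : ∀ {n} {v : Vec (Fin N) n} → v ∈ arrangements N n → Distinct v
  ∈-arrangements⁻ {n} = proj₂ ∘ ∈-filter⁻ distinct? {xs = allVecs N n}

  open DecMembership (_≟F_ {N}) using (_∈?_)

  freshColours : ∀ {m} → Vec (Fin N) m → List (Fin N)
  freshColours xs = filter (∁? (_∈? toList xs)) (allFin N)

  extensions : ∀ {m} → Vec (Fin N) m → List (Vec (Fin N) (suc m))
  extensions xs = map (_∷ xs) (freshColours xs)

  length-freshColours : ∀ {m j} → m + j ≡ N → {xs : Vec (Fin N) m} → Distinct xs →
    length (freshColours xs) ≡ j
  length-freshColours {m} {j} m+j≡N {xs} dxs = +-cancelˡ-≡ m _ j (begin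
    m + length (freshColours xs)
      ≡⟨ cong (_+ length (freshColours xs)) (sym length-used) ⟩
    length (filter (_∈? toList xs) (allFin N)) + length (freshColours xs)
      ≡⟨ length-filter-∁ (_∈? toList xs) (allFin N) ⟩
    length (allFin N)
      ≡⟨ length-tabulate id ⟩
    N
      ≡⟨ sym m+j≡N ⟩
    m + j ∎)
    where
    open ≡-Reasoning
    length-used : length (filter (_∈? toList xs) (allFin N)) ≡ m
    length-used = trans
      (unique-⊆-⊇⇒length≡ (filter⁺ (_∈? toList xs) (allFin⁺ N)) dxs
        (proj₂ ∘ ∈-filter⁻ (_∈? toList xs) {xs = allFin N})
        (λ {c} → ∈-filter⁺ (_∈? toList xs) (∈-allFin c)))
      (length-toList xs)

  extensions-unique : ∀ {m} (xs : Vec (Fin N) m) → Unique (extensions xs)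
  extensions-unique xs = map⁺ ∷-injectiveˡ (filter⁺ (∁? (_∈? toList xs)) (allFin⁺ N))

  tail-∈-extensions : ∀ {m} {xs : Vec (Fin N) m} {v} → v ∈ extensions xs → tail v ≡ xs
  tail-∈-extensions {xs = xs} p with ∈-map⁻ (_∷ xs) p
  ... | _ , _ , refl = refl

  arrangements-suc-⊆ : ∀ m → arrangements N (suc m) ⊆ concatMap extensions (arrangements N m)
  arrangements-suc-⊆ m {c ∷ xs} p with ∈-arrangements⁻ p
  ... | c∉xs ∷ dxs = ∈-concat⁺′
    (∈-map⁺ (_∷ xs) (∈-filter⁺ (∁? (_∈? toList xs)) (∈-allFin c) (All¬⇒¬Any c∉xs)))
    (∈-map⁺ extensions (∈-arrangements⁺ dxs))

  arrangements-suc-⊇ : ∀ m → concatMap extensions (arrangements N m) ⊆ arrangements N (suc m)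
  arrangements-suc-⊇ m p with ∈-concat⁻′ (map extensions (arrangements N m)) p
  ... | _ , v∈ext , ext∈ with ∈-map⁻ extensions ext∈
  ...   | xs , xs∈ , refl with ∈-map⁻ (_∷ xs) v∈ext
  ...     | c , c∈fresh , refl = ∈-arrangements⁺
    (¬Any⇒All¬ _ (proj₂ (∈-filter⁻ (∁? (_∈? toList xs)) {xs = allFin N} c∈fresh))
      ∷ ∈-arrangements⁻ xs∈)

  -- The number j of fresh colours is given as m + j ≡ N to avoid truncated subtraction.
  length-arrangements-suc : ∀ {m j} → m + j ≡ N →
    length (arrangements N (suc m)) ≡ length (arrangements N m) * j
  length-arrangements-suc {m} {j} m+j≡N = begin
    length (arrangements N (suc m))
      ≡⟨ unique-⊆-⊇⇒length≡ (arrangements-unique (suc m))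
           (unique-concatMap tail extensions extensions-unique tail-∈-extensions
             (arrangements-unique m))
           (arrangements-suc-⊆ m) (arrangements-suc-⊇ m) ⟩
    length (concatMap extensions (arrangements N m))
      ≡⟨ length-concatMap extensions (arrangements N m) ⟩
    sum (map (length ∘ extensions) (arrangements N m))
      ≡⟨ sum-map-const (length ∘ extensions) (arrangements N m)
           (λ {xs} xs∈ → trans (length-map (_∷ xs) (freshColours xs))
                                (length-freshColours m+j≡N (∈-arrangements⁻ xs∈))) ⟩
    length (arrangements N m) * j ∎
    where open ≡-Reasoning

  length-arrangements : ∀ m {j} → m + j ≡ N → length (arrangements N m) * j ! ≡ N !
  length-arrangements zero    {j} j≡N = trans (*-identityˡ (j !)) (cong _! j≡N)
  length-arrangements (suc m) {j} m+j≡N = begin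
    length (arrangements N (suc m)) * j !
      ≡⟨ cong (_* j !) (length-arrangements-suc m+sucj≡N) ⟩
    length (arrangements N m) * suc j * j !
      ≡⟨ *-assoc (length (arrangements N m)) (suc j) (j !) ⟩
    length (arrangements N m) * suc j !
      ≡⟨ length-arrangements m m+sucj≡N ⟩
    N ! ∎
    where
    open ≡-Reasoning
    m+sucj≡N : m + suc j ≡ N
    m+sucj≡N = trans (+-suc m j) m+j≡N

  hamming-refl : ∀ {n} (xs : Vec (Fin N) n) → hamming xs xs ≡ 0
  hamming-refl []       = refl
  hamming-refl (x ∷ xs) with x ≟F x
  ... | yes _   = hamming-refl xs
  ... | no  x≢x = ⊥-elim (x≢x refl)

  hamming≡0⇒≡ : ∀ {n} (xs ys : Vec (Fin N) n) → hamming xs ys ≡ 0 → xs ≡ ys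
  hamming≡0⇒≡ []       []       _ = refl
  hamming≡0⇒≡ (x ∷ xs) (y ∷ ys) h with x ≟F y | h
  ... | yes refl | h′ = cong (x ∷_) (hamming≡0⇒≡ xs ys h′)
  ... | no  _    | ()

  hamming-∷ : ∀ {n} x (xs ys : Vec (Fin N) n) → hamming (x ∷ xs) (x ∷ ys) ≡ hamming xs ys
  hamming-∷ x xs ys with x ≟F x
  ... | yes _   = refl
  ... | no  x≢x = ⊥-elim (x≢x refl)

  ≢-head-adjacent : ∀ {n} {x y} (xs : Vec (Fin N) n) → x ≢ y → Adjacent (x ∷ xs) (y ∷ xs)
  ≢-head-adjacent {x = x} {y} xs x≢y with x ≟F y
  ... | yes x≡y = ⊥-elim (x≢y x≡y)
  ... | no  _   = cong suc (hamming-refl xs)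

  NoTwoAdjacent : ∀ {n} → (Vec (Fin N) n → Set) → Set
  NoTwoAdjacent P = ∀ {x y} → P x → P y → ¬ Adjacent x y

  wins-noTwoAdjacent : ∀ n (s : Strategy N n) → NoTwoAdjacent (Wins n s)
  wins-noTwoAdjacent zero    _          {[]}     {[]}     _ _ ()
  wins-noTwoAdjacent (suc n) (f , rest) {x ∷ xs} {y ∷ ys} (fxs≡x , wxs) (fys≡y , wys) adj
    with x ≟F y
  ... | yes refl = wins-noTwoAdjacent n (rest x)
          (subst (λ g → Wins n (rest g) xs) fxs≡x wxs)
          (subst (λ g → Wins n (rest g) ys) fys≡y wys) adj
  ... | no  x≢y  = x≢y (trans (sym fxs≡x)
          (trans (cong f (hamming≡0⇒≡ xs ys (suc-injective adj))) fys≡y))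

  witnessOr : {Q : Fin N → Set} → Fin N → Dec (∃ Q) → Fin N
  witnessOr _ (yes (c , _)) = c
  witnessOr d (no  _)       = d

  -- Each prisoner guesses a colour completing the hats he sees to an element of P.
  -- On an element of P every earlier guess was right, so the earlier guesses are
  -- the true earlier colours, and by NoTwoAdjacent P the completion is unique.
  strategyFor : ∀ n → Fin N → (P : Vec (Fin N) n → Set) → Decidable P → Strategy N n
  strategyFor zero    _ _ _  = tt
  strategyFor (suc n) d P P? =
    (λ xs → witnessOr d (any? (λ c → P? (c ∷ xs)))) ,
    (λ g → strategyFor n d (λ ys → P (g ∷ ys)) (λ ys → P? (g ∷ ys)))

  strategyFor-wins : ∀ n d (P : Vec (Fin N) n → Set) (P? : Decidable P) →
    NoTwoAdjacent P → ∀ {x} → P x → Wins n (strategyFor n d P P?) x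
  strategyFor-wins zero    d P P? noAdj {[]}     _  = tt
  strategyFor-wins (suc n) d P P? noAdj {c ∷ xs} px with any? (λ c′ → P? (c′ ∷ xs))
  ... | no  ¬∃        = ⊥-elim (¬∃ (c , px))
  ... | yes (c′ , pc′) with c′ ≟F c
  ...   | no  c′≢c = ⊥-elim (noAdj pc′ px (≢-head-adjacent xs c′≢c))
  ...   | yes refl = refl ,
          strategyFor-wins n d (λ ys → P (c ∷ ys)) (λ ys → P? (c ∷ ys))
            (λ {ys} {zs} pys pzs adj → noAdj pys pzs (trans (hamming-∷ c ys zs) adj)) px

winningSet : ∀ {N} n → Strategy N n → List (Vec (Fin N) n)
winningSet {N} n s = filter (wins? n s) (arrangements N n)

winningSet-independent : ∀ {N} n (s : Strategy N n) → IndependentSet N n (winningSet n s)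
winningSet-independent {N} n s =
  filter⁺ (wins? n s) (arrangements-unique n) ,
  All.tabulate (∈-arrangements⁻ ∘ proj₁ ∘ ∈-filter⁻ (wins? n s) {xs = arrangements N n}) ,
  λ p q → wins-noTwoAdjacent n s (wins p) (wins q)
  where
  wins : ∀ {x} → x ∈ winningSet n s → Wins n s x
  wins = proj₂ ∘ ∈-filter⁻ (wins? n s) {xs = arrangements N n}

strategyFrom : ∀ {N n} → Fin N → List (Vec (Fin N) n) → Strategy N n
strategyFrom {N} {n} d S = strategyFor n d (_∈ S) (_∈? S)
  where open DecMembership (≡-dec (_≟F_ {N})) using (_∈?_)

independentSet⊆winningSet : ∀ {N n S} (d : Fin N) → IndependentSet N n S →
  S ⊆ winningSet n (strategyFrom d S)
independentSet⊆winningSet {n = n} d (_ , dS , noAdj) x∈S =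
  ∈-filter⁺ (wins? n _) (∈-arrangements⁺ (All.lookup dS x∈S))
    (strategyFor-wins n d _ _ noAdj x∈S)

independentSet-length≤ : ∀ {N m S} → IndependentSet N (suc m) S →
  length S ≤ length (arrangements N m)
independentSet-length≤ {S = S} (uS , dS , noAdj) =
  injectiveOn⇒length≤ tail uS tail-injective
    (λ x∈S → ∈-arrangements⁺ (tail-distinct (All.lookup dS x∈S)))
  where
  tail-injective : ∀ {x y} → x ∈ S → y ∈ S → tail x ≡ tail y → x ≡ y
  tail-injective {a ∷ xs} {b ∷ .xs} a∷xs∈S b∷xs∈S refl with a ≟F b
  ... | yes a≡b = cong (_∷ xs) a≡b
  ... | no  a≢b = ⊥-elim (noAdj a∷xs∈S b∷xs∈S (≢-head-adjacent xs a≢b))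
  tail-distinct : ∀ {N n} {x : Vec (Fin N) (suc n)} → Distinct x → Distinct (tail x)
  tail-distinct {x = _ ∷ _} (_ ∷ dxs) = dxs

independenceNumber-attained : ∀ {N m S} → IndependentSet N (suc m) S →
  length S ≡ length (arrangements N m) →
  IsIndependenceNumber N (suc m) (length (arrangements N m))
independenceNumber-attained {S = S} indS |S|≡A =
  (S , indS , |S|≡A) , λ _ → independentSet-length≤

perfect⇔ : ∀ {m k} (s : Strategy (suc m + k) (suc m)) →
  Perfect (suc m) k s ⇔ length (winningSet (suc m) s) ≡ length (arrangements (suc m + k) m)
perfect⇔ {m} {k} s = mk⇔
  (λ perfect → *-cancelʳ-≡ _ _ (suc k) (trans perfect length-top))
  (λ |W|≡A → trans (cong (_* suc k) |W|≡A) (sym length-top))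
  where
  length-top : length (arrangements (suc m + k) (suc m)) ≡ length (arrangements (suc m + k) m) * suc k
  length-top = length-arrangements-suc {m = m} (+-suc m k)

target≡length-arrangements : ∀ m k → target (suc m) k ≡ length (arrangements (suc m + k) m)
target≡length-arrangements m k =
  trans (cong (_/ suc k !) (sym (length-arrangements m (+-suc m k)))) (m*n/n≡m _ (suc k !))
  where instance _ = suc k !≢0

theorem1 : (n k : ℕ) → 1 ≤ n → 1 ≤ k →
    (Σ (Strategy (n + k) n) (Perfect n k)) ⇔ IsIndependenceNumber (n + k) n (target n k)
theorem1 zero    k () _
theorem1 (suc m) k _  _ =
  subst (λ α → Σ (Strategy N (suc m)) (Perfect (suc m) k) ⇔ IsIndependenceNumber N (suc m) α)
    (sym (target≡length-arrangements m k)) (mk⇔ perfect⇒α α⇒perfect)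
  where
  N = suc m + k

  perfect⇒α : Σ (Strategy N (suc m)) (Perfect (suc m) k) →
    IsIndependenceNumber N (suc m) (length (arrangements N m))
  perfect⇒α (s , perfect) =
    independenceNumber-attained (winningSet-independent (suc m) s)
      (Equivalence.to (perfect⇔ s) perfect)

  α⇒perfect : IsIndependenceNumber N (suc m) (length (arrangements N m)) →
    Σ (Strategy N (suc m)) (Perfect (suc m) k)
  α⇒perfect ((S , indS , |S|≡A) , _) = s , Equivalence.from (perfect⇔ s)
    (≤-antisym (independentSet-length≤ (winningSet-independent (suc m) s))
      (subst (_≤ length (winningSet (suc m) s)) |S|≡A
        (unique-⊆⇒length≤ (proj₁ indS) (independentSet⊆winningSet zero indS))))
    where s = strategyFrom zero S
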